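{- Let $D$ be a dendriform algebra over a field $k$ of characteristic zero and $\overline D=D\oplus k\mathbf 1$ its unital augmentation. Let $b,d\in D$ and let $Y,Z\in\overline D[[\lambda]]$ satisfy $$Y=\mathbf 1+\lambda\, b\prec Y,\qquad Z=\mathbf 1+\lambda\, Z\succ d.$$ Let $a,c\in D$. Then $E:=Y*\bigl(Y^{ -1}\succ a\bigr)$ satisfies $E=a+\lambda\, b\prec E$, and $F:=\bigl(c\prec Z^{ -1}\bigr)*Z$ satisfies $F=c+\lambda\, F\succ d$.
   Context: A dendriform algebra over $k$ is a $k$-vector space $D$ with bilinear operations $\prec,\succ$ such that for all $a,b,c\in D$: $(a\prec b)\prec c=a\prec(b\prec c+b\succ c)$, $(a\succ b)\prec c=a\succ(b\prec c)$, $a\succ(b\succ c)=(a\prec b+a\succ b)\succ c$. The product $a*b:=a\prec b+a\succ b$ is associative. The augmentation $\overline D=D\oplus k\mathbf 1$ is defined by $a\prec\mathbf 1=a=\mathbf 1\succ a$ and $\mathbf 1\prec a=0=a\succ\mathbf 1$ for $a\in D$ ($\mathbf 1\prec\mathbf 1$, $\mathbf 1\succ\mathbf 1$ undefined), with $\mathbf 1*\mathbf 1=\mathbf 1$. Operations are extended $\lambda$-bilinearly to $\overline D[[\lambda]]$. For $W\in\overline D[[\lambda]]$ with constant term $\mathbf 1$, $W^{ -1}$ denotes its inverse for the associative product $*$. -}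

module Defs where

open import Level using (Level; _⊔_; suc)
open import Data.Nat using (ℕ; zero; _∸_) renaming (suc to sucℕ)
open import Data.Product using (_×_; _,_; ∃)
open import Relation.Nullary using (¬_)
open import Relation.Binary.PropositionalEquality using (_≡_)
open import Algebra.Bundles using (CommutativeRing)
open import Algebra.Module.Bundles using (Module)

record IsField {c ℓ : Level} (R : CommutativeRing c ℓ) : Set (c ⊔ ℓ) where
  open CommutativeRing R
  field
    1≉0     : ¬ (1# ≈ 0#)
    inverse : ∀ x → ¬ (x ≈ 0#) → ∃ λ y → (x * y) ≈ 1#

natMul : {c ℓ : Level} (R : CommutativeRing c ℓ) → ℕ → CommutativeRing.Carrier R
natMul R zero     = CommutativeRing.0# R
natMul R (sucℕ n) = CommutativeRing._+_ R (CommutativeRing.1# R) (natMul R n)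

CharZero : {c ℓ : Level} (R : CommutativeRing c ℓ) → Set ℓ
CharZero R = ∀ n → CommutativeRing._≈_ R (natMul R n) (CommutativeRing.0# R) → n ≡ 0

record Dendriform {c ℓ : Level} (R : CommutativeRing c ℓ) (m ℓm : Level)
                  : Set (c ⊔ ℓ ⊔ suc (m ⊔ ℓm)) where
  open CommutativeRing R using () renaming (Carrier to K)
  field
    module' : Module R m ℓm
  open Module module'
  infixl 7 _≺_ _≻_
  field
    _≺_ : Carrierᴹ → Carrierᴹ → Carrierᴹ
    _≻_ : Carrierᴹ → Carrierᴹ → Carrierᴹ
    ≺-cong      : ∀ {x x' y y'} → x ≈ᴹ x' → y ≈ᴹ y' → (x ≺ y) ≈ᴹ (x' ≺ y')
    ≻-cong      : ∀ {x x' y y'} → x ≈ᴹ x' → y ≈ᴹ y' → (x ≻ y) ≈ᴹ (x' ≻ y')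
    ≺-distribˡ  : ∀ x y z → (x ≺ (y +ᴹ z)) ≈ᴹ ((x ≺ y) +ᴹ (x ≺ z))
    ≺-distribʳ  : ∀ x y z → ((y +ᴹ z) ≺ x) ≈ᴹ ((y ≺ x) +ᴹ (z ≺ x))
    ≻-distribˡ  : ∀ x y z → (x ≻ (y +ᴹ z)) ≈ᴹ ((x ≻ y) +ᴹ (x ≻ z))
    ≻-distribʳ  : ∀ x y z → ((y +ᴹ z) ≻ x) ≈ᴹ ((y ≻ x) +ᴹ (z ≻ x))
    ≺-scaleˡ    : ∀ (r : K) x y → ((r *ₗ x) ≺ y) ≈ᴹ (r *ₗ (x ≺ y))
    ≺-scaleʳ    : ∀ (r : K) x y → (x ≺ (r *ₗ y)) ≈ᴹ (r *ₗ (x ≺ y))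
    ≻-scaleˡ    : ∀ (r : K) x y → ((r *ₗ x) ≻ y) ≈ᴹ (r *ₗ (x ≻ y))
    ≻-scaleʳ    : ∀ (r : K) x y → (x ≻ (r *ₗ y)) ≈ᴹ (r *ₗ (x ≻ y))
    dend₁ : ∀ a b c → ((a ≺ b) ≺ c) ≈ᴹ (a ≺ ((b ≺ c) +ᴹ (b ≻ c)))
    dend₂ : ∀ a b c → ((a ≻ b) ≺ c) ≈ᴹ (a ≻ (b ≺ c))
    dend₃ : ∀ a b c → (a ≻ (b ≻ c)) ≈ᴹ (((a ≺ b) +ᴹ (a ≻ b)) ≻ c)

module Aug {c ℓ m ℓm : Level} {R : CommutativeRing c ℓ} (𝒟 : Dendriform R m ℓm) where
  open CommutativeRing R using (_≈_; _+_; _*_; 0#; 1#) renaming (Carrier to K)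
  open Dendriform 𝒟
  open Module module' using (Carrierᴹ; _≈ᴹ_; _+ᴹ_; _*ₗ_; 0ᴹ)

  D : Set m
  D = Carrierᴹ

  -- (x , α) represents x + α 1
  D̄ : Set (c ⊔ m)
  D̄ = D × K

  infix 4 _≈̄_ _≈ₛ_
  _≈̄_ : D̄ → D̄ → Set (ℓ ⊔ ℓm)
  (x , α) ≈̄ (y , β) = (x ≈ᴹ y) × (α ≈ β)

  ι : D → D̄
  ι x = (x , 0#)

  0̄ 1̄ : D̄
  0̄ = (0ᴹ , 0#)
  1̄ = (0ᴹ , 1#)

  _+̄_ : D̄ → D̄ → D̄
  (x , α) +̄ (y , β) = (x +ᴹ y , α + β)

  -- associative product on D̄:  (x + α1)*(y + β1) = x≺y + x≻y + βx + αy + αβ1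
  _*̄_ : D̄ → D̄ → D̄
  (x , α) *̄ (y , β) = (((x ≺ y) +ᴹ (x ≻ y)) +ᴹ ((β *ₗ x) +ᴹ (α *ₗ y)) , α * β)

  -- the defined parts of ≺ and ≻ on D̄ that are used:  x ≺ (y + β1) = x≺y + βx,
  -- (x + α1) ≻ y = x≻y + αy   (for x, y ∈ D)
  _≺̄_ : D → D̄ → D
  x ≺̄ (y , β) = (x ≺ y) +ᴹ (β *ₗ x)

  _≻̄_ : D̄ → D → D
  (x , α) ≻̄ y = (x ≻ y) +ᴹ (α *ₗ y)

  Series : Set (c ⊔ m)
  Series = ℕ → D̄

  _≈ₛ_ : Series → Series → Set (ℓ ⊔ ℓm)
  X ≈ₛ Y = ∀ n → X n ≈̄ Y n

  const : D̄ → Series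
  const x zero     = x
  const x (sucℕ n) = 0̄

  1ₛ : Series
  1ₛ = const 1̄

  lam· : Series → Series
  lam· X zero     = 0̄
  lam· X (sucℕ n) = X n

  _+ₛ_ : Series → Series → Series
  (X +ₛ Y) n = X n +̄ Y n

  sumUpTo : ℕ → (ℕ → D̄) → D̄
  sumUpTo zero     f = f zero
  sumUpTo (sucℕ n) f = sumUpTo n f +̄ f (sucℕ n)

  _*ₛ_ : Series → Series → Series
  (X *ₛ Y) n = sumUpTo n (λ i → X i *̄ Y (n ∸ i))

  _≺ₛ_ : D → Series → Series
  (b ≺ₛ Y) n = ι (b ≺̄ Y n)

  _≻ₛ_ : Series → D → Series
  (Y ≻ₛ a) n = ι (Y n ≻̄ a)

  IsInverse : Series → Series → Set (ℓ ⊔ ℓm)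
  IsInverse W W' = ((W *ₛ W') ≈ₛ 1ₛ) × ((W' *ₛ W) ≈ₛ 1ₛ)

-- Expand E coefficientwise and split each product as X *̄ ι w = ι (X' ≺ w) + ι (X ≻̄ w), where X'
-- is the D-part of X.  Since ≻̄ is a left action of (D̄, *̄), the ≻-terms add up to
-- (Y * Y⁻¹) ≻ a = const a.  Since ≺̄ is a right action and Y' = λ (b ≺ Y) by the recursion for Y,
-- the ≺-terms add up to λ (b ≺ (Y * (Y⁻¹ ≻ a))) = λ (b ≺ E).  The identity for F is the mirror image.
module Submission where

open import Defs
open import Level using (Level; _⊔_)
open import Data.Product using (_×_; _,_; proj₁)
open import Data.Nat using (ℕ; zero; suc; _≤_; z≤n; _∸_)
open import Data.Nat.Properties using (≤-refl; m≤n⇒m≤1+n; +-∸-assoc; n∸n≡0)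
open import Relation.Binary.PropositionalEquality using (_≡_; cong)
open import Algebra.Bundles using (CommutativeRing; CommutativeMonoid)
open import Algebra.Module.Bundles using (Module)
import Algebra.Construct.DirectProduct as DirectProduct
import Algebra.Solver.CommutativeMonoid as CommutativeMonoidSolver
import Relation.Binary.Reasoning.Setoid as SetoidReasoning
import Algebra.Properties.CommutativeSemigroup as CommutativeSemigroupProperties

module Augmentation {c ℓ m ℓm : Level} {R : CommutativeRing c ℓ} (𝒟 : Dendriform R m ℓm) where
  open Aug 𝒟
  open Dendriform 𝒟
  module K = CommutativeRing R
  open Module module'
  module ≈ᴹ-Reasoning = SetoidReasoning ≈ᴹ-setoid
  open CommutativeMonoidSolver +ᴹ-commutativeMonoid using (solve; _⊜_; _⊕_; id)
  open CommutativeSemigroupProperties (CommutativeMonoid.commutativeSemigroup +ᴹ-commutativeMonoid)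
    using () renaming (interchange to +ᴹ-interchange)

  *ₗ-homo⇒0ᴹ-homo : (f : D → D) → (∀ {x y} → x ≈ᴹ y → f x ≈ᴹ f y) →
                    (∀ r x → f (r *ₗ x) ≈ᴹ r *ₗ f x) → f 0ᴹ ≈ᴹ 0ᴹ
  *ₗ-homo⇒0ᴹ-homo f f-cong f-scale = begin
    f 0ᴹ             ≈⟨ f-cong (≈ᴹ-sym (*ₗ-zeroˡ 0ᴹ)) ⟩
    f (K.0# *ₗ 0ᴹ)   ≈⟨ f-scale K.0# 0ᴹ ⟩
    K.0# *ₗ f 0ᴹ     ≈⟨ *ₗ-zeroˡ _ ⟩
    0ᴹ               ∎
    where open ≈ᴹ-Reasoning

  ≺-zeroˡ : ∀ x → 0ᴹ ≺ x ≈ᴹ 0ᴹ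
  ≺-zeroˡ x = *ₗ-homo⇒0ᴹ-homo (_≺ x) (λ p → ≺-cong p ≈ᴹ-refl) (λ r y → ≺-scaleˡ r y x)

  ≺-zeroʳ : ∀ x → x ≺ 0ᴹ ≈ᴹ 0ᴹ
  ≺-zeroʳ x = *ₗ-homo⇒0ᴹ-homo (x ≺_) (≺-cong ≈ᴹ-refl) (λ r y → ≺-scaleʳ r x y)

  ≻-zeroˡ : ∀ x → 0ᴹ ≻ x ≈ᴹ 0ᴹ
  ≻-zeroˡ x = *ₗ-homo⇒0ᴹ-homo (_≻ x) (λ p → ≻-cong p ≈ᴹ-refl) (λ r y → ≻-scaleˡ r y x)

  ≻-zeroʳ : ∀ x → x ≻ 0ᴹ ≈ᴹ 0ᴹ
  ≻-zeroʳ x = *ₗ-homo⇒0ᴹ-homo (x ≻_) (≻-cong ≈ᴹ-refl) (λ r y → ≻-scaleʳ r x y)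

  -- Its equality and addition are ≈̄ and +̄ definitionally.
  +̄-commutativeMonoid : CommutativeMonoid (m ⊔ c) (ℓm ⊔ ℓ)
  +̄-commutativeMonoid = DirectProduct.commutativeMonoid +ᴹ-commutativeMonoid K.+-commutativeMonoid

  module ≈̄-Reasoning = SetoidReasoning (CommutativeMonoid.setoid +̄-commutativeMonoid)
  open CommutativeMonoid +̄-commutativeMonoid using ()
    renaming ( refl to ≈̄-refl; sym to ≈̄-sym; trans to ≈̄-trans; reflexive to ≈̄-reflexive
             ; ∙-cong to +̄-cong; assoc to +̄-assoc; comm to +̄-comm
             ; identityˡ to +̄-identityˡ; identityʳ to +̄-identityʳ)
  open CommutativeSemigroupProperties (CommutativeMonoid.commutativeSemigroup +̄-commutativeMonoid)
    using () renaming (interchange to +̄-interchange)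

  ι-cong : ∀ {x y} → x ≈ᴹ y → ι x ≈̄ ι y
  ι-cong p = p , K.refl

  ι-+ : ∀ x y → ι (x +ᴹ y) ≈̄ ι x +̄ ι y
  ι-+ x y = ≈ᴹ-refl , K.sym (K.+-identityˡ K.0#)

  sumUpTo-cong : ∀ n {f g : ℕ → D̄} → (∀ i → i ≤ n → f i ≈̄ g i) → sumUpTo n f ≈̄ sumUpTo n g
  sumUpTo-cong zero    f≈g = f≈g 0 z≤n
  sumUpTo-cong (suc n) f≈g =
    +̄-cong (sumUpTo-cong n (λ i i≤n → f≈g i (m≤n⇒m≤1+n i≤n))) (f≈g (suc n) ≤-refl)

  sumUpTo-+̄ : ∀ n (f g : ℕ → D̄) → sumUpTo n (λ i → f i +̄ g i) ≈̄ sumUpTo n f +̄ sumUpTo n g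
  sumUpTo-+̄ zero    f g = ≈̄-refl
  sumUpTo-+̄ (suc n) f g = ≈̄-trans (+̄-cong (sumUpTo-+̄ n f g) ≈̄-refl) (+̄-interchange _ _ _ _)

  sumUpTo-shift : ∀ n (f : ℕ → D̄) → sumUpTo (suc n) f ≈̄ f 0 +̄ sumUpTo n (λ i → f (suc i))
  sumUpTo-shift zero    f = ≈̄-refl
  sumUpTo-shift (suc n) f = ≈̄-trans (+̄-cong (sumUpTo-shift n f) ≈̄-refl) (+̄-assoc _ _ _)

  ι-sumUpTo : (h : D̄ → D) → (∀ X X' → h (X +̄ X') ≈ᴹ h X +ᴹ h X') →
              ∀ n f → ι (h (sumUpTo n f)) ≈̄ sumUpTo n (λ i → ι (h (f i)))
  ι-sumUpTo h h-+ zero    f = ≈̄-refl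
  ι-sumUpTo h h-+ (suc n) f =
    ≈̄-trans (ι-cong (h-+ _ _)) (≈̄-trans (ι-+ _ _) (+̄-cong (ι-sumUpTo h h-+ n f) ≈̄-refl))

  ≺̄-cong : ∀ x {X X'} → X ≈̄ X' → x ≺̄ X ≈ᴹ x ≺̄ X'
  ≺̄-cong x (p , q) = +ᴹ-cong (≺-cong ≈ᴹ-refl p) (*ₗ-cong q ≈ᴹ-refl)

  ≻̄-cong : ∀ {X X'} x → X ≈̄ X' → X ≻̄ x ≈ᴹ X' ≻̄ x
  ≻̄-cong x (p , q) = +ᴹ-cong (≻-cong p ≈ᴹ-refl) (*ₗ-cong q ≈ᴹ-refl)

  ≺̄-+̄ : ∀ x X X' → x ≺̄ (X +̄ X') ≈ᴹ (x ≺̄ X) +ᴹ (x ≺̄ X')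
  ≺̄-+̄ x (y , α) (y' , α') = begin
    x ≺ (y +ᴹ y') +ᴹ (α K.+ α') *ₗ x                ≈⟨ +ᴹ-cong (≺-distribˡ x y y') (*ₗ-distribʳ x α α') ⟩
    (x ≺ y +ᴹ x ≺ y') +ᴹ (α *ₗ x +ᴹ α' *ₗ x)        ≈⟨ +ᴹ-interchange _ _ _ _ ⟩
    (x ≺ y +ᴹ α *ₗ x) +ᴹ (x ≺ y' +ᴹ α' *ₗ x)        ∎
    where open ≈ᴹ-Reasoning

  ≻̄-+̄ : ∀ x X X' → (X +̄ X') ≻̄ x ≈ᴹ (X ≻̄ x) +ᴹ (X' ≻̄ x)
  ≻̄-+̄ x (y , α) (y' , α') = begin
    (y +ᴹ y') ≻ x +ᴹ (α K.+ α') *ₗ x                ≈⟨ +ᴹ-cong (≻-distribʳ x y y') (*ₗ-distribʳ x α α') ⟩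
    (y ≻ x +ᴹ y' ≻ x) +ᴹ (α *ₗ x +ᴹ α' *ₗ x)        ≈⟨ +ᴹ-interchange _ _ _ _ ⟩
    (y ≻ x +ᴹ α *ₗ x) +ᴹ (y' ≻ x +ᴹ α' *ₗ x)        ∎
    where open ≈ᴹ-Reasoning

  ≺̄-ι : ∀ x y → x ≺̄ ι y ≈ᴹ x ≺ y
  ≺̄-ι x y = ≈ᴹ-trans (+ᴹ-cong ≈ᴹ-refl (*ₗ-zeroˡ x)) (+ᴹ-identityʳ _)

  ι-≻̄ : ∀ x y → ι x ≻̄ y ≈ᴹ x ≻ y
  ι-≻̄ x y = ≈ᴹ-trans (+ᴹ-cong ≈ᴹ-refl (*ₗ-zeroˡ y)) (+ᴹ-identityʳ _)

  ≺̄-1̄ : ∀ x → x ≺̄ 1̄ ≈ᴹ x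
  ≺̄-1̄ x = ≈ᴹ-trans (+ᴹ-cong (≺-zeroʳ x) (*ₗ-identityˡ x)) (+ᴹ-identityˡ x)

  ≺̄-0̄ : ∀ x → x ≺̄ 0̄ ≈ᴹ 0ᴹ
  ≺̄-0̄ x = ≈ᴹ-trans (≺̄-ι x 0ᴹ) (≺-zeroʳ x)

  1̄-≻̄ : ∀ x → 1̄ ≻̄ x ≈ᴹ x
  1̄-≻̄ x = ≈ᴹ-trans (+ᴹ-cong (≻-zeroˡ x) (*ₗ-identityˡ x)) (+ᴹ-identityˡ x)

  0̄-≻̄ : ∀ x → 0̄ ≻̄ x ≈ᴹ 0ᴹ
  0̄-≻̄ x = ≈ᴹ-trans (ι-≻̄ 0ᴹ x) (≻-zeroˡ x)

  -- D is a right and a left module over (D̄, *̄) via ≺̄ and ≻̄: this is the content of dend₁ and dend₃.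
  ≺̄-*̄ : ∀ x X X' → (x ≺̄ X) ≺̄ X' ≈ᴹ x ≺̄ (X *̄ X')
  ≺̄-*̄ x (y , α) (y' , β) = begin
    (x ≺ y +ᴹ α *ₗ x) ≺ y' +ᴹ β *ₗ (x ≺ y +ᴹ α *ₗ x)
      ≈⟨ +ᴹ-cong (≺-distribʳ y' _ _) (*ₗ-distribˡ β _ _) ⟩
    ((x ≺ y) ≺ y' +ᴹ (α *ₗ x) ≺ y') +ᴹ (β *ₗ (x ≺ y) +ᴹ β *ₗ (α *ₗ x))
      ≈⟨ +ᴹ-cong (+ᴹ-cong (dend₁ x y y') (≺-scaleˡ α x y'))
                 (+ᴹ-cong (≈ᴹ-sym (≺-scaleʳ β x y)) (≈ᴹ-trans (≈ᴹ-sym (*ₗ-assoc β α x)) (*ₗ-cong (K.*-comm β α) ≈ᴹ-refl))) ⟩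
    (x ≺ P +ᴹ α *ₗ (x ≺ y')) +ᴹ (x ≺ (β *ₗ y) +ᴹ (α K.* β) *ₗ x)
      ≈⟨ +ᴹ-cong (+ᴹ-cong ≈ᴹ-refl (≈ᴹ-sym (≺-scaleʳ α x y'))) ≈ᴹ-refl ⟩
    (x ≺ P +ᴹ x ≺ (α *ₗ y')) +ᴹ (x ≺ (β *ₗ y) +ᴹ (α K.* β) *ₗ x)
      ≈⟨ solve 4 (λ p q r s → (p ⊕ q) ⊕ (r ⊕ s) ⊜ (p ⊕ (r ⊕ q)) ⊕ s) ≈ᴹ-refl _ _ _ _ ⟩
    (x ≺ P +ᴹ (x ≺ (β *ₗ y) +ᴹ x ≺ (α *ₗ y'))) +ᴹ (α K.* β) *ₗ x
      ≈⟨ +ᴹ-cong (≈ᴹ-trans (+ᴹ-cong ≈ᴹ-refl (≈ᴹ-sym (≺-distribˡ x _ _))) (≈ᴹ-sym (≺-distribˡ x _ _))) ≈ᴹ-refl ⟩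
    x ≺ (P +ᴹ (β *ₗ y +ᴹ α *ₗ y')) +ᴹ (α K.* β) *ₗ x ∎
    where open ≈ᴹ-Reasoning
          P = y ≺ y' +ᴹ y ≻ y'

  ≻̄-*̄ : ∀ X X' x → X ≻̄ (X' ≻̄ x) ≈ᴹ (X *̄ X') ≻̄ x
  ≻̄-*̄ (y , α) (y' , β) x = begin
    y ≻ (y' ≻ x +ᴹ β *ₗ x) +ᴹ α *ₗ (y' ≻ x +ᴹ β *ₗ x)
      ≈⟨ +ᴹ-cong (≻-distribˡ y _ _) (*ₗ-distribˡ α _ _) ⟩
    (y ≻ (y' ≻ x) +ᴹ y ≻ (β *ₗ x)) +ᴹ (α *ₗ (y' ≻ x) +ᴹ α *ₗ (β *ₗ x))
      ≈⟨ +ᴹ-cong (+ᴹ-cong (dend₃ y y' x) (≈ᴹ-trans (≻-scaleʳ β y x) (≈ᴹ-sym (≻-scaleˡ β y x))))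
                 (+ᴹ-cong (≈ᴹ-sym (≻-scaleˡ α y' x)) (≈ᴹ-sym (*ₗ-assoc α β x))) ⟩
    (P ≻ x +ᴹ (β *ₗ y) ≻ x) +ᴹ ((α *ₗ y') ≻ x +ᴹ (α K.* β) *ₗ x)
      ≈⟨ solve 4 (λ p q r s → (p ⊕ q) ⊕ (r ⊕ s) ⊜ (p ⊕ (q ⊕ r)) ⊕ s) ≈ᴹ-refl _ _ _ _ ⟩
    (P ≻ x +ᴹ ((β *ₗ y) ≻ x +ᴹ (α *ₗ y') ≻ x)) +ᴹ (α K.* β) *ₗ x
      ≈⟨ +ᴹ-cong (≈ᴹ-trans (+ᴹ-cong ≈ᴹ-refl (≈ᴹ-sym (≻-distribʳ x _ _))) (≈ᴹ-sym (≻-distribʳ x _ _))) ≈ᴹ-refl ⟩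
    (P +ᴹ (β *ₗ y +ᴹ α *ₗ y')) ≻ x +ᴹ (α K.* β) *ₗ x ∎
    where open ≈ᴹ-Reasoning
          P = y ≺ y' +ᴹ y ≻ y'

  *̄-ι : ∀ X y → X *̄ ι y ≈̄ ι (proj₁ X ≺ y) +̄ ι (X ≻̄ y)
  *̄-ι (x , α) y =
    ≈ᴹ-trans (+ᴹ-cong ≈ᴹ-refl (+ᴹ-cong (*ₗ-zeroˡ x) ≈ᴹ-refl))
             (solve 3 (λ p q r → (p ⊕ q) ⊕ (id ⊕ r) ⊜ p ⊕ (q ⊕ r)) ≈ᴹ-refl _ _ _)
    , K.trans (K.zeroʳ α) (K.sym (K.+-identityˡ K.0#))

  ι-*̄ : ∀ x Y → ι x *̄ Y ≈̄ ι (x ≺̄ Y) +̄ ι (x ≻ proj₁ Y)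
  ι-*̄ x (y , β) =
    ≈ᴹ-trans (+ᴹ-cong ≈ᴹ-refl (+ᴹ-cong ≈ᴹ-refl (*ₗ-zeroˡ y)))
             (solve 3 (λ p q r → (p ⊕ q) ⊕ (r ⊕ id) ⊜ (p ⊕ r) ⊕ q) ≈ᴹ-refl _ _ _)
    , K.trans (K.zeroˡ β) (K.sym (K.+-identityˡ K.0#))

  1ₛ-≻̄ : ∀ x n → ι (1ₛ n ≻̄ x) ≈̄ const (ι x) n
  1ₛ-≻̄ x zero    = ι-cong (1̄-≻̄ x)
  1ₛ-≻̄ x (suc n) = ι-cong (0̄-≻̄ x)

  ≺̄-1ₛ : ∀ x n → ι (x ≺̄ 1ₛ n) ≈̄ const (ι x) n
  ≺̄-1ₛ x zero    = ι-cong (≺̄-1̄ x)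
  ≺̄-1ₛ x (suc n) = ι-cong (≺̄-0̄ x)

  module LeftRecursion (b : D) (Y Y⁻¹ : Series) (Y-rec : Y ≈ₛ 1ₛ +ₛ lam· (b ≺ₛ Y))
                       (Y*Y⁻¹ : (Y *ₛ Y⁻¹) ≈ₛ 1ₛ) (a : D) where
    E : Series
    E = Y *ₛ (Y⁻¹ ≻ₛ a)

    w : ℕ → D
    w i = Y⁻¹ i ≻̄ a

    Y-coeff₀ : proj₁ (Y 0) ≈ᴹ 0ᴹ
    Y-coeff₀ = ≈ᴹ-trans (proj₁ (Y-rec 0)) (+ᴹ-identityˡ 0ᴹ)

    Y-coeffₛ : ∀ j → proj₁ (Y (suc j)) ≈ᴹ b ≺̄ Y j
    Y-coeffₛ j = ≈ᴹ-trans (proj₁ (Y-rec (suc j))) (+ᴹ-identityˡ _)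

    first-term : ∀ v → ι (proj₁ (Y 0) ≺ v) ≈̄ 0̄
    first-term v = ι-cong (≈ᴹ-trans (≺-cong Y-coeff₀ ≈ᴹ-refl) (≺-zeroˡ v))

    ≻-part : ∀ n → sumUpTo n (λ i → ι (Y i ≻̄ w (n ∸ i))) ≈̄ const (ι a) n
    ≻-part n = begin
      sumUpTo n (λ i → ι (Y i ≻̄ w (n ∸ i)))         ≈⟨ sumUpTo-cong n (λ i _ → ι-cong (≻̄-*̄ (Y i) (Y⁻¹ (n ∸ i)) a)) ⟩
      sumUpTo n (λ i → ι ((Y i *̄ Y⁻¹ (n ∸ i)) ≻̄ a)) ≈⟨ ≈̄-sym (ι-sumUpTo (_≻̄ a) (≻̄-+̄ a) n _) ⟩
      ι ((Y *ₛ Y⁻¹) n ≻̄ a)                          ≈⟨ ι-cong (≻̄-cong a (Y*Y⁻¹ n)) ⟩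
      ι (1ₛ n ≻̄ a)                                  ≈⟨ 1ₛ-≻̄ a n ⟩
      const (ι a) n                                 ∎
      where open ≈̄-Reasoning

    ≺-part : ∀ n → sumUpTo n (λ i → ι (proj₁ (Y i) ≺ w (n ∸ i))) ≈̄ lam· (b ≺ₛ E) n
    ≺-part zero    = first-term (w 0)
    ≺-part (suc n) = begin
      sumUpTo (suc n) (λ i → ι (proj₁ (Y i) ≺ w (suc n ∸ i)))
        ≈⟨ sumUpTo-shift n _ ⟩
      ι (proj₁ (Y 0) ≺ w (suc n)) +̄ sumUpTo n (λ j → ι (proj₁ (Y (suc j)) ≺ w (n ∸ j)))
        ≈⟨ +̄-cong (first-term (w (suc n))) (sumUpTo-cong n (λ j _ → ι-cong (term j))) ⟩
      0̄ +̄ sumUpTo n (λ j → ι (b ≺̄ (Y j *̄ ι (w (n ∸ j)))))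
        ≈⟨ +̄-identityˡ _ ⟩
      sumUpTo n (λ j → ι (b ≺̄ (Y j *̄ ι (w (n ∸ j)))))
        ≈⟨ ≈̄-sym (ι-sumUpTo (b ≺̄_) (≺̄-+̄ b) n _) ⟩
      ι (b ≺̄ E n) ∎
      where
      open ≈̄-Reasoning
      term : ∀ j → proj₁ (Y (suc j)) ≺ w (n ∸ j) ≈ᴹ b ≺̄ (Y j *̄ ι (w (n ∸ j)))
      term j = ≈ᴹ-trans (≺-cong (Y-coeffₛ j) ≈ᴹ-refl)
                 (≈ᴹ-trans (≈ᴹ-sym (≺̄-ι _ _)) (≺̄-*̄ b (Y j) (ι (w (n ∸ j)))))

    E-rec : E ≈ₛ const (ι a) +ₛ lam· (b ≺ₛ E)
    E-rec n = begin
      E n                                                 ≈⟨ sumUpTo-cong n (λ i _ → *̄-ι (Y i) (w (n ∸ i))) ⟩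
      sumUpTo n (λ i → ι (proj₁ (Y i) ≺ w (n ∸ i)) +̄ ι (Y i ≻̄ w (n ∸ i)))
                                                          ≈⟨ sumUpTo-+̄ n _ _ ⟩
      sumUpTo n (λ i → ι (proj₁ (Y i) ≺ w (n ∸ i))) +̄ sumUpTo n (λ i → ι (Y i ≻̄ w (n ∸ i)))
                                                          ≈⟨ +̄-cong (≺-part n) (≻-part n) ⟩
      lam· (b ≺ₛ E) n +̄ const (ι a) n                     ≈⟨ +̄-comm _ _ ⟩
      const (ι a) n +̄ lam· (b ≺ₛ E) n                     ∎
      where open ≈̄-Reasoning

  module RightRecursion (d : D) (Z Z⁻¹ : Series) (Z-rec : Z ≈ₛ 1ₛ +ₛ lam· (Z ≻ₛ d))
                        (Z⁻¹*Z : (Z⁻¹ *ₛ Z) ≈ₛ 1ₛ) (c : D) where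
    F : Series
    F = (c ≺ₛ Z⁻¹) *ₛ Z

    u : ℕ → D
    u i = c ≺̄ Z⁻¹ i

    Z-coeff₀ : ∀ {k} → k ≡ 0 → proj₁ (Z k) ≈ᴹ 0ᴹ
    Z-coeff₀ k≡0 = ≈ᴹ-trans (proj₁ (≈̄-reflexive (cong Z k≡0))) (≈ᴹ-trans (proj₁ (Z-rec 0)) (+ᴹ-identityˡ 0ᴹ))

    Z-coeffₛ : ∀ {k} j → k ≡ suc j → proj₁ (Z k) ≈ᴹ Z j ≻̄ d
    Z-coeffₛ j k≡1+j = ≈ᴹ-trans (proj₁ (≈̄-reflexive (cong Z k≡1+j))) (≈ᴹ-trans (proj₁ (Z-rec (suc j))) (+ᴹ-identityˡ _))

    ≺-part : ∀ n → sumUpTo n (λ i → ι (u i ≺̄ Z (n ∸ i))) ≈̄ const (ι c) n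
    ≺-part n = begin
      sumUpTo n (λ i → ι (u i ≺̄ Z (n ∸ i)))          ≈⟨ sumUpTo-cong n (λ i _ → ι-cong (≺̄-*̄ c (Z⁻¹ i) (Z (n ∸ i)))) ⟩
      sumUpTo n (λ i → ι (c ≺̄ (Z⁻¹ i *̄ Z (n ∸ i)))) ≈⟨ ≈̄-sym (ι-sumUpTo (c ≺̄_) (≺̄-+̄ c) n _) ⟩
      ι (c ≺̄ (Z⁻¹ *ₛ Z) n)                          ≈⟨ ι-cong (≺̄-cong c (Z⁻¹*Z n)) ⟩
      ι (c ≺̄ 1ₛ n)                                  ≈⟨ ≺̄-1ₛ c n ⟩
      const (ι c) n                                 ∎
      where open ≈̄-Reasoning

    last-term : ∀ n → ι (u n ≻ proj₁ (Z (n ∸ n))) ≈̄ 0̄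
    last-term n = ι-cong (≈ᴹ-trans (≻-cong ≈ᴹ-refl (Z-coeff₀ (n∸n≡0 n))) (≻-zeroʳ _))

    ≻-part : ∀ n → sumUpTo n (λ i → ι (u i ≻ proj₁ (Z (n ∸ i)))) ≈̄ lam· (F ≻ₛ d) n
    ≻-part zero    = last-term 0
    ≻-part (suc n) = begin
      -- the summand i = suc n, where suc n ∸ suc n computes only to n ∸ n, is split off
      sumUpTo n (λ i → ι (u i ≻ proj₁ (Z (suc n ∸ i)))) +̄ ι (u (suc n) ≻ proj₁ (Z (n ∸ n)))
        ≈⟨ +̄-cong (sumUpTo-cong n (λ i i≤n → ι-cong (term i i≤n))) (last-term (suc n)) ⟩
      sumUpTo n (λ i → ι ((ι (u i) *̄ Z (n ∸ i)) ≻̄ d)) +̄ 0̄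
        ≈⟨ +̄-identityʳ _ ⟩
      sumUpTo n (λ i → ι ((ι (u i) *̄ Z (n ∸ i)) ≻̄ d))
        ≈⟨ ≈̄-sym (ι-sumUpTo (_≻̄ d) (≻̄-+̄ d) n _) ⟩
      ι (F n ≻̄ d) ∎
      where
      open ≈̄-Reasoning
      term : ∀ i → i ≤ n → u i ≻ proj₁ (Z (suc n ∸ i)) ≈ᴹ (ι (u i) *̄ Z (n ∸ i)) ≻̄ d
      term i i≤n = ≈ᴹ-trans (≻-cong ≈ᴹ-refl (Z-coeffₛ (n ∸ i) (+-∸-assoc 1 i≤n)))
                     (≈ᴹ-trans (≈ᴹ-sym (ι-≻̄ _ _)) (≻̄-*̄ (ι (u i)) (Z (n ∸ i)) d))

    F-rec : F ≈ₛ const (ι c) +ₛ lam· (F ≻ₛ d)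
    F-rec n = begin
      F n                                                 ≈⟨ sumUpTo-cong n (λ i _ → ι-*̄ (u i) (Z (n ∸ i))) ⟩
      sumUpTo n (λ i → ι (u i ≺̄ Z (n ∸ i)) +̄ ι (u i ≻ proj₁ (Z (n ∸ i))))
                                                          ≈⟨ sumUpTo-+̄ n _ _ ⟩
      sumUpTo n (λ i → ι (u i ≺̄ Z (n ∸ i))) +̄ sumUpTo n (λ i → ι (u i ≻ proj₁ (Z (n ∸ i))))
                                                          ≈⟨ +̄-cong (≺-part n) (≻-part n) ⟩
      const (ι c) n +̄ lam· (F ≻ₛ d) n                     ∎
      where open ≈̄-Reasoning

mainTheorem2 : {c ℓ m ℓm : Level} (R : CommutativeRing c ℓ) → IsField R → CharZero R →
    (𝒟 : Dendriform R m ℓm) →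
    let open Aug 𝒟 in
    (b d : D) (Y Z Yinv Zinv : Series) →
    Y ≈ₛ (1ₛ +ₛ lam· (b ≺ₛ Y)) →
    Z ≈ₛ (1ₛ +ₛ lam· (Z ≻ₛ d)) →
    IsInverse Y Yinv →
    IsInverse Z Zinv →
    (a c : D) →
    let E = Y *ₛ (Yinv ≻ₛ a)
        F = (c ≺ₛ Zinv) *ₛ Z
    in (E ≈ₛ (const (ι a) +ₛ lam· (b ≺ₛ E)))
       × (F ≈ₛ (const (ι c) +ₛ lam· (F ≻ₛ d)))
mainTheorem2 R _ _ 𝒟 b d Y Z Yinv Zinv Y-rec Z-rec (Y*Yinv , _) (_ , Zinv*Z) a c =
  LeftRecursion.E-rec b Y Yinv Y-rec Y*Yinv a , RightRecursion.F-rec d Z Zinv Z-rec Zinv*Z c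
  where open Augmentation 𝒟
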